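{- For every integer $k$, every incidence graph $G$ and every literal $x_\star$ of $G$: if $\mathrm{srbd}_{\mathscr{C}_0}(G)\le k$, then $\mathrm{srbd}_{\mathscr{C}_0}(G[x_\star])\le k$.
   Context: CNF formulas are identified with incidence graphs: bipartite graphs on variables and clauses, with a positive edge $\{x,c\}$ if $x_+\in c$ and a negative edge if $x_-\in c$ (no clause contains both). $G[x_\star]$ is the incidence graph of the formula obtained by setting $x$ to $\star\in\{+,-\}$: delete clauses containing $x_\star$ and delete the opposite literal of $x$ from the remaining clauses. $\mathscr{C}_0$ is the class of formulas with no clauses or only empty clauses (edgeless incidence graphs). For a class $\mathscr{C}$: $\mathrm{srbd}_{\mathscr{C}}(G)=0$ if $G\in\mathscr{C}$; $=1+\min_{x\in\mathrm{var}(G)}\max_{\star}\mathrm{srbd}_{\mathscr{C}}(G[x_\star])$ if $G\notin\mathscr{C}$ and $G$ is connected; otherwise the maximum of $\mathrm{srbd}_{\mathscr{C}}(H)$ over connected components $H$ of $G$. -}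

module Defs where

open import Data.Nat using (ℕ; zero; suc; _⊔_; _⊓_; _≡ᵇ_)
open import Data.Bool using (Bool; true; false; not; _∧_; if_then_else_)
open import Data.List using (List; []; _∷_; map; filterᵇ; concat; concatMap; foldr; length; null)
open import Data.Bool.ListAction using (any; all)
open import Data.Nat.ListAction using (sum)
open import Data.List.Relation.Unary.All using (All)
open import Data.List.Relation.Unary.Unique.Propositional using (Unique)
open import Data.Product using (_×_; _,_; proj₁)
open import Function using (_∘_)

-- Variables are natural numbers; a literal x_⋆ is (x , ⋆) with
-- ⋆ = true meaning x_+ and ⋆ = false meaning x_-.
Var : Set
Var = ℕ

Literal : Set
Literal = Var × Bool

-- A clause is a list of literals; a formula (incidence graph) is a list of
-- clauses (each list entry is one clause vertex).
Clause : Set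
Clause = List Literal

CNF : Set
CNF = List Clause

-- Well-formedness of an incidence graph: in every clause each variable
-- occurs at most once (simple graph, and no clause contains both x_+ and x_-).
WF : CNF → Set
WF F = All (λ c → Unique (map proj₁ c)) F

boolEq : Bool → Bool → Bool
boolEq true  true  = true
boolEq false false = true
boolEq _     _     = false

litEq : Literal → Literal → Bool
litEq (x , a) (y , b) = (x ≡ᵇ y) ∧ boolEq a b

occurs : Literal → Clause → Bool
occurs l c = any (litEq l) c

hasVar : Var → Clause → Bool
hasVar x c = any (λ l → proj₁ l ≡ᵇ x) c

vars : CNF → List Var
vars F = concatMap (map proj₁) F

-- G[x_⋆]: delete clauses containing x_⋆, delete x_{¬⋆} from remaining clauses
setLit : Var → Bool → CNF → CNF
setLit x b F =
  map (filterᵇ (λ l → not (litEq l (x , not b))))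
      (filterᵇ (λ c → not (occurs (x , b) c)) F)

-- class 𝒞₀: no clauses or only empty clauses (edgeless incidence graph)
isC0 : CNF → Bool
isC0 F = all null F

-- connected components (on clause vertices; isolated variable vertices are
-- edgeless components and contribute 0): two clauses are adjacent iff they
-- share a variable.
shares : Clause → Clause → Bool
shares c d = any (λ l → hasVar (proj₁ l) d) c

touches : Clause → List Clause → Bool
touches c g = any (shares c) g

insertComp : Clause → List CNF → List CNF
insertComp c gs = (c ∷ concat (filterᵇ (touches c) gs)) ∷ filterᵇ (not ∘ touches c) gs

components : CNF → List CNF
components = foldr insertComp []

-- minimum of f over a list (0 on the empty list; only used on nonempty lists)
minOver : List Var → (Var → ℕ) → ℕ
minOver []       f = 0
minOver (x ∷ xs) f = foldr (λ y m → f y ⊓ m) (f x) xs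

-- number of edges (total literal occurrences); used as recursion fuel
size : CNF → ℕ
size F = sum (map length F)

mutual
  srbdF : ℕ → CNF → ℕ
  srbdF fuel F = foldr (λ C m → srbdC fuel C ⊔ m) 0 (components F)

  srbdC : ℕ → CNF → ℕ
  srbdC zero       C = 0
  srbdC (suc fuel) C =
    if isC0 C then 0
    else suc (minOver (vars C)
               (λ x → srbdF fuel (setLit x true C) ⊔ srbdF fuel (setLit x false C)))

-- srbd_{𝒞₀}(G). The fuel size G suffices: each branching step removes at
-- least one edge, and a non-𝒞₀ component has at least one edge.
srbd : CNF → ℕ
srbd F = srbdF (size F) F

-- Restriction by x⋆ commutes with restriction by any other literal, and every component of
-- G[x⋆] lies inside D[x⋆] for a component D of G; so it suffices to treat a connected G that
-- branches optimally on some y with both G[y±] of depth ≤ k - 1. If y = x, then G[x⋆] is one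
-- of these branches. Otherwise G[x⋆][y_c] = G[y_c][x⋆] has depth ≤ k - 1 by induction, and
-- branching on y in G[x⋆] gives depth ≤ k. The induction runs on the recursion fuel of srbdF;
-- the value is monotone in the fuel and G[x⋆] is no larger than G, so the bound transfers to srbd.

module Submission where

open import Defs
open import Data.Nat using (ℕ; _≤_)
open import Data.Bool using (Bool)
open import Data.List.Membership.Propositional using (_∈_)
open import Data.Nat using (zero; suc; _⊔_; _⊓_; z≤n; s≤s; _≤′_; ≤′-refl; ≤′-step)
open import Data.Nat.Properties
open import Data.Bool using (true; false; not; T)
open import Data.Bool.Properties using (T-≡; T-∧)
open import Data.List using (List; []; _∷_; map; filterᵇ; concat; foldr; length; null)
open import Data.List.Properties using (map-∘; map-cong; filter-≐; filter-all; length-filter)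
import Data.List.Relation.Unary.All as All
open import Data.List.Relation.Unary.All.Properties using (all-anti-mono)
open import Data.List.Relation.Unary.Any using (here; there)
import Data.List.Relation.Unary.Any as Any
open import Data.List.Relation.Unary.Any.Properties using (any⁺; any⁻; map⁺; map⁻)
open import Data.List.Membership.Propositional using (_∉_; find; lose)
open import Data.List.Membership.Propositional.Properties
  using (∈-map⁺; ∈-map⁻; ∈-filter⁺; ∈-filter⁻; ∈-concat⁺′; ∈-concat⁻′;
         ∈-concatMap⁺; ∈-concatMap⁻)
open import Data.List.Membership.DecPropositional _≟_ using (_∈?_)
open import Data.List.Relation.Binary.Subset.Propositional using (_⊆_)
import Data.List.Relation.Binary.Subset.Propositional.Properties as Subset
open import Data.Product using (∃; _×_; _,_; proj₁; proj₂)
open import Data.Sum using (inj₁; inj₂)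
open import Function using (_∘_; id; _⇔_; mk⇔; Equivalence)
open import Function.Properties.Equivalence using (⇔-isEquivalence)
open import Relation.Binary.PropositionalEquality
open import Relation.Binary.Construct.Closure.Equivalence as EqClosure using (EqClosure)
open import Relation.Binary.Construct.Closure.ReflexiveTransitive using (ε; _◅◅_)
open import Relation.Nullary using (¬_; yes; no; contradiction)
open import Relation.Nullary.Decidable using (T?)
open import Relation.Unary using (_≐_)

module _ {A : Set} where

  ∈-filterᵇ⁺ : ∀ (p : A → Bool) {xs x} → x ∈ xs → T (p x) → x ∈ filterᵇ p xs
  ∈-filterᵇ⁺ p = ∈-filter⁺ (T? ∘ p)

  ∈-filterᵇ⁻ : ∀ (p : A → Bool) {xs x} → x ∈ filterᵇ p xs → x ∈ xs × T (p x)
  ∈-filterᵇ⁻ p = ∈-filter⁻ (T? ∘ p)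

  filterᵇ-comm : ∀ (p q : A → Bool) xs → filterᵇ p (filterᵇ q xs) ≡ filterᵇ q (filterᵇ p xs)
  filterᵇ-comm p q [] = refl
  filterᵇ-comm p q (x ∷ xs) with p x in px | q x in qx
  ... | true  | true  rewrite px | qx = cong (x ∷_) (filterᵇ-comm p q xs)
  ... | true  | false rewrite qx = filterᵇ-comm p q xs
  ... | false | true  rewrite px = filterᵇ-comm p q xs
  ... | false | false = filterᵇ-comm p q xs

  filterᵇ-map : ∀ {B : Set} (p : B → Bool) (f : A → B) xs →
    filterᵇ p (map f xs) ≡ map f (filterᵇ (p ∘ f) xs)
  filterᵇ-map p f [] = refl
  filterᵇ-map p f (x ∷ xs) with p (f x)
  ... | true  = cong (f x ∷_) (filterᵇ-map p f xs)
  ... | false = filterᵇ-map p f xs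

T-not⁺ : ∀ {b} → ¬ T b → T (not b)
T-not⁺ {false} _ = _
T-not⁺ {true} ¬t = ¬t _

T-not⁻ : ∀ {b} → T (not b) → ¬ T b
T-not⁻ {false} _ ()

boolEq⇒≡ : ∀ a b → T (boolEq a b) → a ≡ b
boolEq⇒≡ true  true  _ = refl
boolEq⇒≡ false false _ = refl
boolEq⇒≡ true  false ()
boolEq⇒≡ false true  ()

boolEq-refl : ∀ a → T (boolEq a a)
boolEq-refl true  = _
boolEq-refl false = _

litEq⇒≡ : ∀ l l′ → T (litEq l l′) → l ≡ l′
litEq⇒≡ (x , a) (y , b) h =
  let x≡y , a≡b = Equivalence.to T-∧ h in cong₂ _,_ (≡ᵇ⇒≡ x y x≡y) (boolEq⇒≡ a b a≡b)

litEq-refl : ∀ l → T (litEq l l)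
litEq-refl (x , a) = Equivalence.from T-∧ (≡⇒≡ᵇ x x refl , boolEq-refl a)

occurs⇒∈ : ∀ {l} c → T (occurs l c) → l ∈ c
occurs⇒∈ c h = Any.map (litEq⇒≡ _ _) (any⁻ _ c h)

∈⇒occurs : ∀ {l c} → l ∈ c → T (occurs l c)
∈⇒occurs {l} l∈c = any⁺ (litEq l) (Any.map (λ { refl → litEq-refl l }) l∈c)

clauseVars : Clause → List Var
clauseVars = map proj₁

SharesVar : Clause → Clause → Set
SharesVar c d = ∃ λ x → x ∈ clauseVars c × x ∈ clauseVars d

SharesVar-sym : ∀ {c d} → SharesVar c d → SharesVar d c
SharesVar-sym (x , x∈c , x∈d) = x , x∈d , x∈c

SharesVar-mono : ∀ {c c′ d d′} → c ⊆ c′ → d ⊆ d′ → SharesVar c d → SharesVar c′ d′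
SharesVar-mono c⊆c′ d⊆d′ (x , x∈c , x∈d) =
  x , Subset.map⁺ proj₁ c⊆c′ x∈c , Subset.map⁺ proj₁ d⊆d′ x∈d

hasVar⇒∈ : ∀ {x} d → T (hasVar x d) → x ∈ clauseVars d
hasVar⇒∈ d h = map⁺ (Any.map (λ p → sym (≡ᵇ⇒≡ _ _ p)) (any⁻ _ d h))

∈⇒hasVar : ∀ {x} d → x ∈ clauseVars d → T (hasVar x d)
∈⇒hasVar d x∈d = any⁺ _ (Any.map (λ x≡ → ≡⇒≡ᵇ _ _ (sym x≡)) (map⁻ x∈d))

shares⇒SharesVar : ∀ c d → T (shares c d) → SharesVar c d
shares⇒SharesVar c d h =
  let l , l∈c , hasVar-l = find (any⁻ _ c h) in
  proj₁ l , ∈-map⁺ proj₁ l∈c , hasVar⇒∈ d hasVar-l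

touches⁺ : ∀ {c g d} → d ∈ g → SharesVar c d → T (touches c g)
touches⁺ {c} {g} {d} d∈g (x , x∈c , x∈d) =
  let l , l∈c , x≡l = ∈-map⁻ proj₁ x∈c in
  any⁺ _ (lose d∈g (any⁺ _ (lose l∈c (∈⇒hasVar d (subst (_∈ clauseVars d) x≡l x∈d)))))

touches⁻ : ∀ c g → T (touches c g) → ∃ λ d → d ∈ g × SharesVar c d
touches⁻ c g h = let d , d∈g , s = find (any⁻ _ g h) in d , d∈g , shares⇒SharesVar c d s

∈-vars⁺ : ∀ {F x c} → c ∈ F → x ∈ clauseVars c → x ∈ vars F
∈-vars⁺ c∈F x∈c = ∈-concatMap⁺ clauseVars (lose c∈F x∈c)

vars-mono : ∀ {X F} → X ⊆ F → vars X ⊆ vars F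
vars-mono {X} X⊆F x∈ =
  let c , c∈X , x∈c = find (∈-concatMap⁻ clauseVars {xs = X} x∈) in ∈-vars⁺ (X⊆F c∈X) x∈c

-- Connected components

ClosedIn : CNF → CNF → Set
ClosedIn X F = ∀ {d c} → d ∈ X → c ∈ F → SharesVar d c → c ∈ X

⊇⇒ClosedIn : ∀ {X F} → F ⊆ X → ClosedIn X F
⊇⇒ClosedIn F⊆X _ c∈F _ = F⊆X c∈F

ClosedIn-⊆ : ∀ {X F Y} → ClosedIn X F → Y ⊆ F → ClosedIn X Y
ClosedIn-⊆ closed Y⊆F d∈X c∈Y = closed d∈X (Y⊆F c∈Y)

ClosedIn-trans : ∀ {E X F} → ClosedIn E X → E ⊆ X → ClosedIn X F → ClosedIn E F
ClosedIn-trans E-closed E⊆X X-closed d∈E c∈F s = E-closed d∈E (X-closed (E⊆X d∈E) c∈F s) s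

Adjacent : CNF → Clause → Clause → Set
Adjacent X c d = c ∈ X × d ∈ X × SharesVar c d

Adjacent-mono : ∀ {X Y c d} → X ⊆ Y → Adjacent X c d → Adjacent Y c d
Adjacent-mono X⊆Y (c∈X , d∈X , s) = X⊆Y c∈X , X⊆Y d∈X , s

Connected : CNF → Set
Connected X = ∀ {c d} → c ∈ X → d ∈ X → EqClosure (Adjacent X) c d

connected⊆closed : ∀ {X F Y c} → Connected X → X ⊆ F → ClosedIn Y F →
                   c ∈ X → c ∈ Y → X ⊆ Y
connected⊆closed {X} {F} {Y} connected X⊆F closed c∈X c∈Y d∈X =
  Equivalence.to (EqClosure.gfold ⇔-isEquivalence (_∈ Y) adjacent⇒⇔ (connected c∈X d∈X)) c∈Y
  where
  adjacent⇒⇔ : ∀ {a b} → Adjacent X a b → (a ∈ Y) ⇔ (b ∈ Y)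
  adjacent⇒⇔ (a∈X , b∈X , s) =
    mk⇔ (λ a∈Y → closed a∈Y (X⊆F b∈X) s)
        (λ b∈Y → closed b∈Y (X⊆F a∈X) (SharesVar-sym s))

∈-components-⊆ : ∀ F {D} → D ∈ components F → D ⊆ F
∈-components-⊆ (c ∷ F) (here refl) (here refl) = here refl
∈-components-⊆ (c ∷ F) (here refl) (there d∈) =
  let H , d∈H , H∈ = ∈-concat⁻′ _ d∈ in
  there (∈-components-⊆ F (proj₁ (∈-filterᵇ⁻ (touches c) H∈)) d∈H)
∈-components-⊆ (c ∷ F) (there D∈) =
  there ∘ ∈-components-⊆ F (proj₁ (∈-filterᵇ⁻ (not ∘ touches c) D∈))

components-cover : ∀ F {c} → c ∈ F → ∃ λ D → D ∈ components F × c ∈ D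
components-cover (c ∷ F) (here refl) = _ , here refl , here refl
components-cover (c ∷ F) (there c′∈F) with components-cover F c′∈F
... | G , G∈ , c′∈G with T? (touches c G)
...   | yes t = _ , here refl , there (∈-concat⁺′ c′∈G (∈-filterᵇ⁺ (touches c) G∈ t))
...   | no ¬t = G , there (∈-filterᵇ⁺ (not ∘ touches c) G∈ (T-not⁺ ¬t)) , c′∈G

components-closed : ∀ F {D} → D ∈ components F → ClosedIn D F
components-closed (c ∷ F) (here refl) _ (here refl) _ = here refl
components-closed (c ∷ F) (here refl) (here refl) (there c′∈F) s =
  let G , G∈ , c′∈G = components-cover F c′∈F in
  there (∈-concat⁺′ c′∈G (∈-filterᵇ⁺ (touches c) G∈ (touches⁺ c′∈G s)))
components-closed (c ∷ F) (here refl) (there d∈) (there c′∈F) s =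
  let H , d∈H , H∈ = ∈-concat⁻′ _ d∈ in
  let H∈F = proj₁ (∈-filterᵇ⁻ (touches c) H∈) in
  there (∈-concat⁺′ (components-closed F H∈F d∈H c′∈F s) H∈)
components-closed (c ∷ F) (there D∈) d∈D (here refl) s =
  contradiction (touches⁺ d∈D (SharesVar-sym s))
                (T-not⁻ (proj₂ (∈-filterᵇ⁻ (not ∘ touches c) {components F} D∈)))
components-closed (c ∷ F) (there D∈) d∈D (there c′∈F) s =
  components-closed F (proj₁ (∈-filterᵇ⁻ (not ∘ touches c) D∈)) d∈D c′∈F s

components-connected : ∀ F {D} → D ∈ components F → Connected D
components-connected (c ∷ F) (there D∈) =
  components-connected F (proj₁ (∈-filterᵇ⁻ (not ∘ touches c) D∈))
components-connected (c ∷ F) (here refl) a∈ b∈ =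
  EqClosure.transitive _ (EqClosure.symmetric _ (from-c a∈)) (from-c b∈)
  where
  D = c ∷ concat (filterᵇ (touches c) (components F))
  from-c : ∀ {a} → a ∈ D → EqClosure (Adjacent D) c a
  from-c (here refl) = ε
  from-c (there a∈) =
    let H , a∈H , H∈ = ∈-concat⁻′ _ a∈
        H∈F , touching = ∈-filterᵇ⁻ (touches c) H∈
        h , h∈H , s = touches⁻ c H touching
        H⊆D = λ {x} (x∈H : x ∈ H) → there (∈-concat⁺′ x∈H H∈)
    in EqClosure.return (here refl , H⊆D h∈H , s)
       ◅◅ EqClosure.map (Adjacent-mono H⊆D) (components-connected F H∈F h∈H a∈H)

-- Restriction G[x⋆]

survives : Var → Bool → Clause → Bool
survives x b c = not (occurs (x , b) c)

restrict : Var → Bool → Clause → Clause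
restrict x b = filterᵇ (λ l → not (litEq l (x , not b)))

survives⇒∉ : ∀ x b c → T (survives x b c) → (x , b) ∉ c
survives⇒∉ x b c h = T-not⁻ h ∘ ∈⇒occurs

∉⇒survives : ∀ x b c → (x , b) ∉ c → T (survives x b c)
∉⇒survives x b c x∉c = T-not⁺ (x∉c ∘ occurs⇒∈ c)

restrict-⊆ : ∀ x b {c} → restrict x b c ⊆ c
restrict-⊆ x b = proj₁ ∘ ∈-filterᵇ⁻ _

∈-restrict⁺ : ∀ {x y a} c {d} → x ≢ y → (x , a) ∈ d → (x , a) ∈ restrict y c d
∈-restrict⁺ c x≢y x∈d = ∈-filterᵇ⁺ _ x∈d (T-not⁺ (x≢y ∘ cong proj₁ ∘ litEq⇒≡ _ _))

restrict-id : ∀ x b {c} → x ∉ clauseVars c → restrict x b c ≡ c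
restrict-id x b x∉c = filter-all (T? ∘ _) (All.tabulate λ l∈c → T-not⁺ λ l≡ →
  x∉c (subst (_∈ _) (cong proj₁ (litEq⇒≡ _ _ l≡)) (∈-map⁺ proj₁ l∈c)))

∈-setLit⁻ : ∀ x b F {e} → e ∈ setLit x b F →
            ∃ λ c → c ∈ F × (x , b) ∉ c × e ≡ restrict x b c
∈-setLit⁻ x b F e∈ =
  let c , c∈ , e≡ = ∈-map⁻ (restrict x b) e∈
      c∈F , c-survives = ∈-filterᵇ⁻ (survives x b) c∈
  in c , c∈F , survives⇒∉ x b c c-survives , e≡

∈-setLit⁺ : ∀ x b {F c} → c ∈ F → (x , b) ∉ c → restrict x b c ∈ setLit x b F
∈-setLit⁺ x b c∈F x∉c =
  ∈-map⁺ (restrict x b) (∈-filterᵇ⁺ (survives x b) c∈F (∉⇒survives x b _ x∉c))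

setLit-mono : ∀ x b {X F} → X ⊆ F → setLit x b X ⊆ setLit x b F
setLit-mono x b {X} X⊆F e∈ with ∈-setLit⁻ x b X e∈
... | c , c∈X , x∉c , refl = ∈-setLit⁺ x b (X⊆F c∈X) x∉c

setLit-closed : ∀ x b {X F} → ClosedIn X F → ClosedIn (setLit x b X) (setLit x b F)
setLit-closed x b {X} {F} closed d′∈ c′∈ s with ∈-setLit⁻ x b X d′∈ | ∈-setLit⁻ x b F c′∈
... | d , d∈X , _ , refl | c , c∈F , x∉c , refl =
  ∈-setLit⁺ x b (closed d∈X c∈F (SharesVar-mono (restrict-⊆ x b) (restrict-⊆ x b) s)) x∉c

untouched-⊆-setLit : ∀ y b {E F} → E ⊆ F → y ∉ vars E → E ⊆ setLit y b F
untouched-⊆-setLit y b E⊆F y∉E d∈E =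
  subst (_∈ _) (restrict-id y b (y∉E ∘ ∈-vars⁺ d∈E))
        (∈-setLit⁺ y b (E⊆F d∈E) (y∉E ∘ ∈-vars⁺ d∈E ∘ ∈-map⁺ proj₁))

untouched-closed-setLit : ∀ y b {E F} → ClosedIn E F → y ∉ vars E → ClosedIn E (setLit y b F)
untouched-closed-setLit y b {E} {F} closed y∉E d∈E c′∈ s with ∈-setLit⁻ y b F c′∈
... | c , c∈F , _ , refl =
  let c∈E = closed d∈E c∈F (SharesVar-mono id (restrict-⊆ y b) s) in
  subst (_∈ E) (sym (restrict-id y b (y∉E ∘ ∈-vars⁺ c∈E))) c∈E

component-setLit-⊆ : ∀ x b F {e E} → e ∷ E ∈ components (setLit x b F) →
  ∃ λ D → D ∈ components F × e ∷ E ⊆ setLit x b D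
component-setLit-⊆ x b F E∈ =
  let c , c∈F , x∉c , e≡ = ∈-setLit⁻ x b F (∈-components-⊆ (setLit x b F) E∈ (here refl))
      D , D∈ , c∈D = components-cover F c∈F
      e∈ = subst (_∈ setLit x b D) (sym e≡) (∈-setLit⁺ x b c∈D x∉c)
  in D , D∈ , connected⊆closed (components-connected (setLit x b F) E∈)
                                (∈-components-⊆ (setLit x b F) E∈)
                                (setLit-closed x b (components-closed F D∈)) (here refl) e∈

survives-restrict : ∀ {x y} b c → x ≢ y → ∀ d →
                    T (survives x b (restrict y c d)) ⇔ T (survives x b d)
survives-restrict {x} {y} b c x≢y d = mk⇔
  (λ h → ∉⇒survives x b d (survives⇒∉ x b (restrict y c d) h ∘ ∈-restrict⁺ c x≢y))
  (λ h → ∉⇒survives x b (restrict y c d) (survives⇒∉ x b d h ∘ restrict-⊆ y c))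

setLit∘setLit : ∀ x b y c F → x ≢ y →
  setLit x b (setLit y c F) ≡
  map (restrict x b ∘ restrict y c) (filterᵇ (survives x b) (filterᵇ (survives y c) F))
setLit∘setLit x b y c F x≢y = begin
  map (restrict x b) (filterᵇ (survives x b) (map (restrict y c) (filterᵇ (survives y c) F)))
    ≡⟨ cong (map (restrict x b)) (filterᵇ-map (survives x b) (restrict y c) survivors) ⟩
  map (restrict x b) (map (restrict y c) (filterᵇ (survives x b ∘ restrict y c) survivors))
    ≡⟨ cong (map (restrict x b) ∘ map (restrict y c))
            (filter-≐ (T? ∘ (survives x b ∘ restrict y c)) (T? ∘ survives x b) same-survivors survivors) ⟩
  map (restrict x b) (map (restrict y c) (filterᵇ (survives x b) (filterᵇ (survives y c) F)))
    ≡⟨ map-∘ {g = restrict x b} {f = restrict y c} _ ⟨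
  map (restrict x b ∘ restrict y c) (filterᵇ (survives x b) (filterᵇ (survives y c) F)) ∎
  where
  open ≡-Reasoning
  survivors = filterᵇ (survives y c) F
  same-survivors : (T ∘ survives x b ∘ restrict y c) ≐ (T ∘ survives x b)
  same-survivors = (λ {d} → Equivalence.to (survives-restrict b c x≢y d))
                 , (λ {d} → Equivalence.from (survives-restrict b c x≢y d))

setLit-comm : ∀ x b y c F → x ≢ y → setLit x b (setLit y c F) ≡ setLit y c (setLit x b F)
setLit-comm x b y c F x≢y = begin
  setLit x b (setLit y c F)
    ≡⟨ setLit∘setLit x b y c F x≢y ⟩
  map (restrict x b ∘ restrict y c) (filterᵇ (survives x b) (filterᵇ (survives y c) F))
    ≡⟨ map-cong (λ d → filterᵇ-comm _ _ d) _ ⟩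
  map (restrict y c ∘ restrict x b) (filterᵇ (survives x b) (filterᵇ (survives y c) F))
    ≡⟨ cong (map _) (filterᵇ-comm _ _ F) ⟩
  map (restrict y c ∘ restrict x b) (filterᵇ (survives y c) (filterᵇ (survives x b) F))
    ≡⟨ setLit∘setLit y c x b F (x≢y ∘ sym) ⟨
  setLit y c (setLit x b F) ∎
  where open ≡-Reasoning

module _ {A : Set} (h : A → ℕ) where

  foldr-⊔-lub : ∀ xs {k} → (∀ {x} → x ∈ xs → h x ≤ k) →
                foldr (λ x m → h x ⊔ m) 0 xs ≤ k
  foldr-⊔-lub []       _   = z≤n
  foldr-⊔-lub (x ∷ xs) ≤k = ⊔-lub (≤k (here refl)) (foldr-⊔-lub xs (≤k ∘ there))

  ≤-foldr-⊔ : ∀ {xs x} → x ∈ xs → h x ≤ foldr (λ x m → h x ⊔ m) 0 xs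
  ≤-foldr-⊔ {x ∷ xs} (here refl) = m≤m⊔n (h x) _
  ≤-foldr-⊔ {y ∷ xs} (there x∈) = ≤-trans (≤-foldr-⊔ x∈) (m≤n⊔m (h y) _)

module _ (f : Var → ℕ) where

  foldr-⊓-≤ : ∀ b xs {y} → y ∈ xs → foldr (λ y m → f y ⊓ m) b xs ≤ f y
  foldr-⊓-≤ b (y ∷ xs) (here refl) = m⊓n≤m (f y) _
  foldr-⊓-≤ b (z ∷ xs) (there y∈) = ≤-trans (m⊓n≤n (f z) _) (foldr-⊓-≤ b xs y∈)

  foldr-⊓-≤-base : ∀ b xs → foldr (λ y m → f y ⊓ m) b xs ≤ b
  foldr-⊓-≤-base b []       = ≤-refl
  foldr-⊓-≤-base b (y ∷ xs) = ≤-trans (m⊓n≤n (f y) _) (foldr-⊓-≤-base b xs)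

  foldr-⊓-attained : ∀ x xs →
                     ∃ λ y → y ∈ x ∷ xs × foldr (λ y m → f y ⊓ m) (f x) xs ≡ f y
  foldr-⊓-attained x []       = x , here refl , refl
  foldr-⊓-attained x (y ∷ xs) with ⊓-sel (f y) (foldr (λ y m → f y ⊓ m) (f x) xs)
  ... | inj₁ min≡ = y , there (here refl) , min≡
  ... | inj₂ min≡ = let z , z∈ , rest≡ = foldr-⊓-attained x xs in
    z , ∈-insert z∈ , trans min≡ rest≡
    where
    ∈-insert : ∀ {z} → z ∈ x ∷ xs → z ∈ x ∷ y ∷ xs
    ∈-insert (here refl) = here refl
    ∈-insert (there z∈) = there (there z∈)

  minOver-≤ : ∀ xs {y} → y ∈ xs → minOver xs f ≤ f y
  minOver-≤ (x ∷ xs) (here refl) = foldr-⊓-≤-base (f x) xs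
  minOver-≤ (x ∷ xs) (there y∈)  = foldr-⊓-≤ (f x) xs y∈

  minOver-attained : ∀ xs {y₀} → y₀ ∈ xs → ∃ λ y → y ∈ xs × minOver xs f ≡ f y
  minOver-attained (x ∷ xs) _ = foldr-⊓-attained x xs

  minOver-≤-bound : ∀ xs {k} → (∀ y → f y ≤ k) → minOver xs f ≤ k
  minOver-≤-bound []       _   = z≤n
  minOver-≤-bound (x ∷ xs) f≤k = ≤-trans (minOver-≤ (x ∷ xs) (here refl)) (f≤k x)

minOver-mono : ∀ xs {f g : Var → ℕ} → (∀ y → f y ≤ g y) → minOver xs f ≤ minOver xs g
minOver-mono []       _   = z≤n
minOver-mono (x ∷ xs) {f} {g} f≤g =
  let y , y∈ , min≡ = minOver-attained g (x ∷ xs) (here refl) in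
  ≤-trans (minOver-≤ f (x ∷ xs) y∈) (≤-trans (f≤g y) (≤-reflexive (sym min≡)))

minOver-suc : ∀ xs (f : Var → ℕ) → minOver xs (suc ∘ f) ≤ suc (minOver xs f)
minOver-suc []       _ = z≤n
minOver-suc (x ∷ xs) f =
  let y , y∈ , min≡ = minOver-attained f (x ∷ xs) (here refl) in
  ≤-trans (minOver-≤ (suc ∘ f) (x ∷ xs) y∈) (s≤s (≤-reflexive (sym min≡)))

minOver-resp : ∀ {xs ys} {f g : Var → ℕ} → xs ⊆ ys → ys ⊆ xs → (∀ y → f y ≡ g y) →
  minOver xs f ≡ minOver ys g
minOver-resp {[]} {[]} _ _ _ = refl
minOver-resp {[]} {y ∷ ys} _ ys⊆[] _ with ys⊆[] (here refl)
... | ()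
minOver-resp {x ∷ xs} {ys} {f} {g} xs⊆ys ys⊆xs f≗g =
  let y , y∈ , minf≡ = minOver-attained f (x ∷ xs) (here refl)
      z , z∈ , ming≡ = minOver-attained g ys (xs⊆ys (here refl))
  in ≤-antisym
       (≤-trans (minOver-≤ f (x ∷ xs) (ys⊆xs z∈)) (≤-reflexive (trans (f≗g z) (sym ming≡))))
       (≤-trans (minOver-≤ g ys (xs⊆ys y∈)) (≤-reflexive (trans (sym (f≗g y)) (sym minf≡))))

-- srbd with explicit fuel

isC0-⊆ : ∀ {X F} → X ⊆ F → isC0 F ≡ true → isC0 X ≡ true
isC0-⊆ X⊆F = Equivalence.to T-≡ ∘ all-anti-mono null X⊆F ∘ Equivalence.from T-≡

isC0-resp : ∀ {X F} → X ⊆ F → F ⊆ X → isC0 X ≡ isC0 F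
isC0-resp {X} {F} X⊆F F⊆X with isC0 F in F-C0
... | true = isC0-⊆ X⊆F F-C0
... | false with isC0 X in X-C0
...   | false = refl
...   | true  = trans (sym (isC0-⊆ F⊆X X-C0)) F-C0

isC0-setLit : ∀ x b F → isC0 F ≡ true → isC0 (setLit x b F) ≡ true
isC0-setLit x b []       _    = refl
isC0-setLit x b ([] ∷ F) F-C0 = isC0-setLit x b F F-C0

isC0≡false⇒var : ∀ F → isC0 F ≡ false → ∃ λ x → x ∈ vars F
isC0≡false⇒var ([] ∷ F)              F-C0 = isC0≡false⇒var F F-C0
isC0≡false⇒var (((x , _) ∷ c) ∷ F) _    = x , here refl

srbdC-C0 : ∀ f {C} → isC0 C ≡ true → srbdC f C ≡ 0
srbdC-C0 zero    _    = refl
srbdC-C0 (suc f) C-C0 rewrite C-C0 = refl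

srbdF-lub : ∀ f F {k} → (∀ {D} → D ∈ components F → srbdC f D ≤ k) → srbdF f F ≤ k
srbdF-lub f F = foldr-⊔-lub (srbdC f) (components F)

component-srbdC≤srbdF : ∀ f F {D} → D ∈ components F → srbdC f D ≤ srbdF f F
component-srbdC≤srbdF f F = ≤-foldr-⊔ (srbdC f)

srbdF-zero : ∀ F → srbdF zero F ≡ 0
srbdF-zero F = n≤0⇒n≡0 (srbdF-lub zero F λ _ → z≤n)

srbdF-C0 : ∀ f {F} → isC0 F ≡ true → srbdF f F ≡ 0
srbdF-C0 f {F} F-C0 = n≤0⇒n≡0 (srbdF-lub f F λ D∈ →
  ≤-reflexive (srbdC-C0 f (isC0-⊆ (∈-components-⊆ F D∈) F-C0)))

branchValue : ℕ → CNF → Var → ℕ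
branchValue f C x = srbdF f (setLit x true C) ⊔ srbdF f (setLit x false C)

mutual
  -- E is, as a set of clauses, the component of F through its first clause.
  srbdC≤srbdF : ∀ f {E F} → Connected E → E ⊆ F → ClosedIn E F → srbdC f E ≤ srbdF f F
  srbdC≤srbdF f {[]} _ _ _ = ≤-trans (≤-reflexive (srbdC-C0 f refl)) z≤n
  srbdC≤srbdF f {e ∷ E} {F} E-connected E⊆F E-closed =
    let D , D∈ , e∈D = components-cover F (E⊆F (here refl))
        E⊆D = connected⊆closed E-connected E⊆F (components-closed F D∈) (here refl) e∈D
        D⊆E = connected⊆closed (components-connected F D∈) (∈-components-⊆ F D∈)
                               E-closed e∈D (here refl)
    in ≤-trans (≤-reflexive (srbdC-resp f E⊆D D⊆E)) (component-srbdC≤srbdF f F D∈)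

  srbdF-mono-closed : ∀ f {X F} → X ⊆ F → ClosedIn X F → srbdF f X ≤ srbdF f F
  srbdF-mono-closed f {X} X⊆F X-closed = srbdF-lub f X λ E∈ →
    srbdC≤srbdF f (components-connected X E∈) (X⊆F ∘ ∈-components-⊆ X E∈)
      (ClosedIn-trans (components-closed X E∈) (∈-components-⊆ X E∈) X-closed)

  srbdC-resp : ∀ f {D E} → D ⊆ E → E ⊆ D → srbdC f D ≡ srbdC f E
  srbdC-resp zero _ _ = refl
  srbdC-resp (suc f) {D} {E} D⊆E E⊆D rewrite isC0-resp D⊆E E⊆D with isC0 E
  ... | true  = refl
  ... | false = cong suc (minOver-resp (vars-mono D⊆E) (vars-mono E⊆D) λ x →
                  cong₂ _⊔_ (same-branch x true) (same-branch x false))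
    where
    same-branch : ∀ x b → srbdF f (setLit x b D) ≡ srbdF f (setLit x b E)
    same-branch x b = ≤-antisym
      (srbdF-mono-closed f (setLit-mono x b D⊆E) (⊇⇒ClosedIn (setLit-mono x b E⊆D)))
      (srbdF-mono-closed f (setLit-mono x b E⊆D) (⊇⇒ClosedIn (setLit-mono x b D⊆E)))

mutual
  srbdC-suc-≤ : ∀ f C → srbdC (suc f) C ≤ suc (srbdC f C)
  srbdC-suc-≤ zero C with isC0 C
  ... | true  = z≤n
  ... | false = s≤s (minOver-≤-bound _ (vars C) λ x →
                  ≤-reflexive (cong₂ _⊔_ (srbdF-zero (setLit x true C))
                                         (srbdF-zero (setLit x false C))))
  srbdC-suc-≤ (suc f) C with isC0 C
  ... | true  = z≤n
  ... | false = s≤s (≤-trans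
                  (minOver-mono (vars C) λ x →
                     ⊔-mono-≤ (srbdF-suc-≤ f (setLit x true C)) (srbdF-suc-≤ f (setLit x false C)))
                  (minOver-suc (vars C) (branchValue f C)))

  srbdF-suc-≤ : ∀ f F → srbdF (suc f) F ≤ suc (srbdF f F)
  srbdF-suc-≤ f F = srbdF-lub (suc f) F λ D∈ →
    ≤-trans (srbdC-suc-≤ f _) (s≤s (component-srbdC≤srbdF f F D∈))

mutual
  srbdC-≤-suc : ∀ f C → srbdC f C ≤ srbdC (suc f) C
  srbdC-≤-suc zero    C = z≤n
  srbdC-≤-suc (suc f) C with isC0 C
  ... | true  = z≤n
  ... | false = s≤s (minOver-mono (vars C) λ x →
                  ⊔-mono-≤ (srbdF-≤-suc f (setLit x true C)) (srbdF-≤-suc f (setLit x false C)))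

  srbdF-≤-suc : ∀ f F → srbdF f F ≤ srbdF (suc f) F
  srbdF-≤-suc f F = srbdF-lub f F λ D∈ →
    ≤-trans (srbdC-≤-suc f _) (component-srbdC≤srbdF (suc f) F D∈)

srbdF-monoˡ-≤ : ∀ {f f′} F → f ≤ f′ → srbdF f F ≤ srbdF f′ F
srbdF-monoˡ-≤ F = go ∘ ≤⇒≤′
  where
  go : ∀ {f f′} → f ≤′ f′ → srbdF f F ≤ srbdF f′ F
  go ≤′-refl       = ≤-refl
  go {f′ = suc f′} (≤′-step f≤′) = ≤-trans (go f≤′) (srbdF-≤-suc f′ F)

srbdC-suc-≤-branch : ∀ f {C y} → y ∈ vars C → srbdC (suc f) C ≤ suc (branchValue f C y)
srbdC-suc-≤-branch f {C} y∈C with isC0 C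
... | true  = z≤n
... | false = s≤s (minOver-≤ (branchValue f C) (vars C) y∈C)

srbdF-branch : ∀ f G y {k} → (∀ b → srbdF f (setLit y b G) ≤ k) → srbdF (suc f) G ≤ suc k
srbdF-branch f G y {k} branches = srbdF-lub (suc f) G component
  where
  component : ∀ {E} → E ∈ components G → srbdC (suc f) E ≤ suc k
  component {E} E∈ with y ∈? vars E
  ... | yes y∈E =
    ≤-trans (srbdC-suc-≤-branch f {E} y∈E) (s≤s (⊔-lub (inside true) (inside false)))
    where
    inside : ∀ b → srbdF f (setLit y b E) ≤ k
    inside b = ≤-trans (srbdF-mono-closed f (setLit-mono y b (∈-components-⊆ G E∈))
                                            (setLit-closed y b (components-closed G E∈)))
                       (branches b)
  ... | no y∉E = ≤-trans (srbdC-suc-≤ f E) (s≤s (≤-trans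
      (srbdC≤srbdF f (components-connected G E∈)
        (untouched-⊆-setLit y true (∈-components-⊆ G E∈) y∉E)
        (untouched-closed-setLit y true (components-closed G E∈) y∉E))
      (branches true)))

optimal-branching : ∀ f C {k} → isC0 C ≡ false → minOver (vars C) (branchValue f C) ≤ k →
  ∃ λ y → ∀ b → srbdF f (setLit y b C) ≤ k
optimal-branching f C C-C0 min≤k =
  let y , _ , min≡ = minOver-attained (branchValue f C) (vars C) (proj₂ (isC0≡false⇒var C C-C0))
      branch≤k = ≤-trans (≤-reflexive (sym min≡)) min≤k
  in y , λ { true → m⊔n≤o⇒m≤o _ _ branch≤k ; false → m⊔n≤o⇒n≤o _ _ branch≤k }

mutual
  srbdC≤⇒srbdF-setLit≤ : ∀ f D k x b → srbdC f D ≤ k → srbdF f (setLit x b D) ≤ k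
  srbdC≤⇒srbdF-setLit≤ zero D k x b _ = ≤-trans (≤-reflexive (srbdF-zero (setLit x b D))) z≤n
  srbdC≤⇒srbdF-setLit≤ (suc f) D k x b srbd≤k with isC0 D in D-C0 | srbd≤k
  ... | true  | _ = ≤-trans (≤-reflexive (srbdF-C0 (suc f) {setLit x b D} (isC0-setLit x b D D-C0))) z≤n
  ... | false | s≤s min≤k with optimal-branching f D D-C0 min≤k
  ...   | y , branches with y ≟ x
  ...     | yes refl = ≤-trans (srbdF-suc-≤ f (setLit x b D)) (s≤s (branches b))
  ...     | no y≢x = srbdF-branch f (setLit x b D) y λ c →
              subst (λ G → srbdF f G ≤ _) (setLit-comm x b y c D (y≢x ∘ sym))
                    (srbdF≤⇒srbdF-setLit≤ f (setLit y c D) _ x b (branches c))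

  srbdF≤⇒srbdF-setLit≤ : ∀ f F k x b → srbdF f F ≤ k → srbdF f (setLit x b F) ≤ k
  srbdF≤⇒srbdF-setLit≤ f F k x b srbd≤k = srbdF-lub f (setLit x b F) component
    where
    component : ∀ {E} → E ∈ components (setLit x b F) → srbdC f E ≤ k
    component {[]} _ = ≤-trans (≤-reflexive (srbdC-C0 f refl)) z≤n
    component {e ∷ E} E∈ =
      let D , D∈ , E⊆ = component-setLit-⊆ x b F E∈
          E-closed = ClosedIn-⊆ (components-closed (setLit x b F) E∈)
                                (setLit-mono x b (∈-components-⊆ F D∈))
      in ≤-trans (srbdC≤srbdF f (components-connected (setLit x b F) E∈) E⊆ E-closed)
                 (srbdC≤⇒srbdF-setLit≤ f D k x b (≤-trans (component-srbdC≤srbdF f F D∈) srbd≤k))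

size-setLit : ∀ x b F → size (setLit x b F) ≤ size F
size-setLit x b []      = z≤n
size-setLit x b (c ∷ F) with survives x b c
... | true  = +-mono-≤ (length-filter (T? ∘ _) c) (size-setLit x b F)
... | false = ≤-trans (size-setLit x b F) (m≤n+m _ (length c))

lemma5p7 : (k : ℕ) (G : CNF) (x : Var) (⋆ : Bool) → WF G → x ∈ vars G →
    srbd G ≤ k → srbd (setLit x ⋆ G) ≤ k
lemma5p7 k G x ⋆ _ _ srbd≤k =
  ≤-trans (srbdF-monoˡ-≤ (setLit x ⋆ G) (size-setLit x ⋆ G))
          (srbdF≤⇒srbdF-setLit≤ (size G) G k x ⋆ srbd≤k)
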